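{- Let $(G,\sigma)$ be a finite simple graph with a linear ordering of its vertices. Then $FF(G\Box G,\mathrm{lex})=2^{\lceil \log_2 FF(G,\sigma)\rceil}$, where $\mathrm{lex}$ is the lexicographic ordering of $V(G\Box G)$ induced by $\sigma$ on both factors.
   Context: $G\Box G$ is the Cartesian product: vertex set $V(G)\times V(G)$, with $(u,v)\sim(u',v')$ iff either $u=u'$ and $vv'\in E(G)$, or $uu'\in E(G)$ and $v=v'$. The First-Fit coloring with respect to a vertex ordering scans vertices in order and gives each the smallest positive integer not used on its previously colored neighbors; $FF$ denotes the number of colors used. Lexicographic ordering: $(u,v)$ precedes $(u',v')$ iff $\sigma(u)<\sigma(u')$, or $u=u'$ and $\sigma(v)<\sigma(v')$. -}

module Defs where

open import Level using (0ℓ)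
open import Data.Nat using (ℕ; zero; suc; _≟_)
open import Data.Fin using (Fin)
open import Data.Fin.Properties renaming (_≟_ to _≟ᶠ_)
open import Data.Bool using (Bool; true; false; if_then_else_)
open import Data.Product using (_×_; _,_; proj₁; proj₂)
open import Data.List using (List; []; _∷_; map; filter; length; deduplicate; concatMap; any; allFin; _++_; [_])
open import Relation.Nullary using (Dec; yes; no; ¬_; does)
open import Relation.Binary using (Rel; Decidable; Symmetric; Irreflexive)
open import Relation.Binary.PropositionalEquality using (_≡_)
open import Function.Bundles using (_↔_; Inverse)

record SimpleGraph (n : ℕ) : Set₁ where
  field
    Adj     : Rel (Fin n) 0ℓ
    adj?    : Decidable Adj
    sym     : Symmetric Adj
    irrefl  : Irreflexive _≡_ Adj

open SimpleGraph public

data BoxAdj {n : ℕ} (G : SimpleGraph n) : Rel (Fin n × Fin n) 0ℓ where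
  sameFst : ∀ {u v v'} → Adj G v v' → BoxAdj G (u , v) (u , v')
  sameSnd : ∀ {u u' v} → Adj G u u' → BoxAdj G (u , v) (u' , v)

module FirstFit {V : Set} (Adj : Rel V 0ℓ) (adj? : Decidable Adj) where

  nbrColours : V → List (V × ℕ) → List ℕ
  nbrColours v [] = []
  nbrColours v ((w , c) ∷ cs) with adj? v w
  ... | yes _ = c ∷ nbrColours v cs
  ... | no  _ = nbrColours v cs

  _∈?_ : ℕ → List ℕ → Bool
  c ∈? [] = false
  c ∈? (d ∷ ds) = if does (c ≟ d) then true else (c ∈? ds)

  -- smallest integer ≥ start not in the list (fuel = length+1 suffices)
  smallestFrom : ℕ → ℕ → List ℕ → ℕ
  smallestFrom zero    start used = start
  smallestFrom (suc f) start used =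
    if start ∈? used then smallestFrom f (suc start) used else start

  mex₁ : List ℕ → ℕ
  mex₁ used = smallestFrom (suc (length used)) 1 used

  colourAlong : List (V × ℕ) → List V → List (V × ℕ)
  colourAlong done [] = done
  colourAlong done (v ∷ vs) =
    colourAlong (done ++ [ (v , mex₁ (nbrColours v done)) ]) vs

  firstFitColouring : List V → List (V × ℕ)
  firstFitColouring ord = colourAlong [] ord

  FF : List V → ℕ
  FF ord = length (deduplicate _≟_ (map proj₂ (firstFitColouring ord)))

-- The ordering σ : V(G) → {positions}, a bijection Fin n ↔ Fin n
-- (σ v = position of v).  The vertex list in σ-order:
σ-order : ∀ {n} → (Fin n ↔ Fin n) → List (Fin n)
σ-order σ = map (Inverse.from σ) (allFin _)

lex-order : ∀ {n} → (Fin n ↔ Fin n) → List (Fin n × Fin n)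
lex-order σ = concatMap (λ u → map (λ v → (u , v)) (σ-order σ)) (σ-order σ)

box-adj? : ∀ {n} (G : SimpleGraph n) → Decidable (BoxAdj G)
box-adj? G (u , v) (u' , v') with u ≟ᶠ u' | v ≟ᶠ v'
box-adj? G (u , v) (.u , v') | yes _≡_.refl | _ with adj? G v v'
... | yes a = yes (sameFst a)
... | no ¬a = no λ { (sameFst a) → ¬a a ; (sameSnd a) → irrefl G _≡_.refl a }
box-adj? G (u , v) (u' , .v) | no _ | yes _≡_.refl with adj? G u u'
... | yes a = yes (sameSnd a)
... | no ¬a = no λ { (sameFst a) → irrefl G _≡_.refl a ; (sameSnd a) → ¬a a }
box-adj? G (u , v) (u' , v') | no p | no q =
  no λ { (sameFst _) → p _≡_.refl ; (sameSnd _) → q _≡_.refl }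

FF-G : ∀ {n} → SimpleGraph n → (Fin n ↔ Fin n) → ℕ
FF-G G σ = FirstFit.FF (Adj G) (adj? G) (σ-order σ)

FF-G□G-lex : ∀ {n} → SimpleGraph n → (Fin n ↔ Fin n) → ℕ
FF-G□G-lex G σ = FirstFit.FF (BoxAdj G) (box-adj? G) (lex-order σ)

-- Running First-Fit on G along σ produces a colouring c in which every vertex
-- receives the least positive colour missing on its earlier neighbours; its
-- colours are exactly 1, …, M with M = FF(G, σ).  Along the lexicographic
-- order, the earlier neighbours of (u, v) in G □ G are the (u, v′) with v′ an
-- earlier neighbour of v and the (u′, v) with u′ an earlier neighbour of u.
-- Hence, as in the Sprague–Grundy theory of sums of games, First-Fit gives
-- (u, v) the colour 1 + (c u − 1) ⊕ (c v − 1), where ⊕ is the nim-sum: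
-- a ⊕ b is the least number differing from every a ⊕ y with y < b and every
-- x ⊕ b with x < a.  The nim-sums of two numbers below M are exactly the
-- numbers below 2 ^ ⌈log₂ M⌉.

module Submission where

open import Level using (0ℓ)
open import Data.Bool using (Bool; true; false; _xor_)
open import Data.Bool.Properties using (xor-comm; xor-assoc; xor-same; xor-identityʳ)
open import Data.Nat
open import Data.Nat.Properties
open import Data.Nat.Induction using (<-rec)
open import Data.Nat.Logarithm using (⌈log₂_⌉; ⌈log₂⌉-mono-≤; ⌈log₂⌈n/2⌉⌉≡⌈log₂n⌉∸1; ⌈log₂2^n⌉≡n)
open import Data.Fin as Fin using (Fin)
import Data.Fin.Properties as Fin
open import Data.List using (List; []; _∷_; _++_; [_]; map; length; deduplicate; applyUpTo; concatMap)
open import Data.List.Properties using (map-++; map-∘; map-cong-local; ++-assoc; ++-identityʳ; length-applyUpTo)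
open import Data.List.Extrema.Nat using (argmax; f[xs]≤f[argmax])
open import Data.List.Membership.Propositional using (_∈_; _∉_)
open import Data.List.Membership.Propositional.Properties
  using (∈-∃++; ∈-++⁺ˡ; ∈-++⁺ʳ; ∈-deduplicate⁻; ∈-deduplicate⁺; ∈-applyUpTo⁺; ∈-applyUpTo⁻; ∈-map⁺; ∈-map⁻; ∈-allFin; ∈-concat⁺′)
open import Data.List.Relation.Binary.Subset.Propositional using (_⊆_)
open import Data.List.Relation.Binary.Permutation.Propositional.Properties using (∈-resp-↭; shift; ↭-length)
open import Data.List.Relation.Unary.Any using (here; there)
import Data.List.Relation.Unary.All as All
import Data.List.Relation.Unary.All.Properties as All
open import Data.List.Relation.Unary.AllPairs as AllPairs using (AllPairs; _∷_)
import Data.List.Relation.Unary.AllPairs.Properties as AllPairs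
open import Data.List.Relation.Unary.Unique.Propositional using (Unique)
open import Data.List.Relation.Unary.Unique.Propositional.Properties using (applyUpTo⁺₁)
open import Data.List.Relation.Unary.Unique.DecPropositional.Properties using (deduplicate-!)
open import Data.Product using (∃-syntax; _×_; _,_; proj₁; proj₂; <_,_>)
import Data.Product as Product
open import Data.Product.Relation.Binary.Lex.Strict using (×-Lex; ×-asymmetric)
open import Data.Sum using (_⊎_; inj₁; inj₂)
import Data.Sum as Sum
open import Function using (id; _∘_)
open import Function.Bundles using (_↔_; _⇔_; mk⇔; Equivalence; Inverse)
import Function.Properties.Equivalence as ⇔
open import Relation.Nullary using (¬_; yes; no; does; proof; contradiction)
open import Relation.Nullary.Reflects using (Reflects; ofʸ; ofⁿ)
open import Relation.Binary using (Rel; Decidable; DecidableEquality; Asymmetric; tri<; tri≈; tri>)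
open import Relation.Binary.PropositionalEquality hiding ([_])
open import Defs hiding (sym)

-- Nim-sums

-- b ∷ᵇ k = b + 2k: the bit b appended to the binary expansion of k.
infixr 7 _∷ᵇ_

_∷ᵇ_ : Bool → ℕ → ℕ
b     ∷ᵇ suc k = suc (suc (b ∷ᵇ k))
false ∷ᵇ zero  = 0
true  ∷ᵇ zero  = 1

lsb : ℕ → Bool
lsb zero          = false
lsb (suc zero)    = true
lsb (suc (suc n)) = lsb n

lsb-∷ᵇ : ∀ b k → lsb (b ∷ᵇ k) ≡ b
lsb-∷ᵇ false zero    = refl
lsb-∷ᵇ true  zero    = refl
lsb-∷ᵇ b     (suc k) = lsb-∷ᵇ b k

⌊∷ᵇ/2⌋ : ∀ b k → ⌊ b ∷ᵇ k /2⌋ ≡ k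
⌊∷ᵇ/2⌋ false zero    = refl
⌊∷ᵇ/2⌋ true  zero    = refl
⌊∷ᵇ/2⌋ b     (suc k) = cong suc (⌊∷ᵇ/2⌋ b k)

lsb∷ᵇ⌊/2⌋ : ∀ n → lsb n ∷ᵇ ⌊ n /2⌋ ≡ n
lsb∷ᵇ⌊/2⌋ zero          = refl
lsb∷ᵇ⌊/2⌋ (suc zero)    = refl
lsb∷ᵇ⌊/2⌋ (suc (suc n)) = cong (suc ∘ suc) (lsb∷ᵇ⌊/2⌋ n)

∷ᵇ-injective : ∀ {b c k m} → b ∷ᵇ k ≡ c ∷ᵇ m → b ≡ c × k ≡ m
∷ᵇ-injective {b} {c} {k} {m} eq =
  trans (sym (lsb-∷ᵇ b k)) (trans (cong lsb eq) (lsb-∷ᵇ c m)) ,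
  trans (sym (⌊∷ᵇ/2⌋ b k)) (trans (cong ⌊_/2⌋ eq) (⌊∷ᵇ/2⌋ c m))

∷ᵇ-+ : ∀ b k m → b ∷ᵇ (k + m) ≡ false ∷ᵇ k + b ∷ᵇ m
∷ᵇ-+ b zero    m = refl
∷ᵇ-+ b (suc k) m = cong (suc ∘ suc) (∷ᵇ-+ b k m)

false∷ᵇ≡2* : ∀ k → false ∷ᵇ k ≡ 2 * k
false∷ᵇ≡2* zero    = refl
false∷ᵇ≡2* (suc k) = trans (cong (suc ∘ suc) (false∷ᵇ≡2* k)) (cong suc (sym (+-suc k (k + 0))))

2^-suc : ∀ f → 2 ^ suc f ≡ false ∷ᵇ 2 ^ f
2^-suc f = sym (false∷ᵇ≡2* (2 ^ f))

∷ᵇ-<-∷ᵇ : ∀ b c {k m} → k < m → b ∷ᵇ k < c ∷ᵇ m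
∷ᵇ-<-∷ᵇ false c {zero}  {suc m} _         = z<s
∷ᵇ-<-∷ᵇ true  c {zero}  {suc m} _         = s<s z<s
∷ᵇ-<-∷ᵇ b     c {suc k} {suc m} (s≤s k<m) = s<s (s<s (∷ᵇ-<-∷ᵇ b c k<m))

false∷ᵇ<true∷ᵇ : ∀ k → false ∷ᵇ k < true ∷ᵇ k
false∷ᵇ<true∷ᵇ zero    = z<s
false∷ᵇ<true∷ᵇ (suc k) = s<s (s<s (false∷ᵇ<true∷ᵇ k))

∷ᵇ-<-∷ᵇ⁻ : ∀ b c k m → b ∷ᵇ k < c ∷ᵇ m → k < m ⊎ (k ≡ m × b ≡ false × c ≡ true)
∷ᵇ-<-∷ᵇ⁻ false false zero    zero    ()
∷ᵇ-<-∷ᵇ⁻ false true  zero    zero    _                 = inj₂ (refl , refl , refl)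
∷ᵇ-<-∷ᵇ⁻ true  false zero    zero    ()
∷ᵇ-<-∷ᵇ⁻ true  true  zero    zero    (s≤s ())
∷ᵇ-<-∷ᵇ⁻ b     c     zero    (suc m) _                 = inj₁ z<s
∷ᵇ-<-∷ᵇ⁻ b     false (suc k) zero    ()
∷ᵇ-<-∷ᵇ⁻ b     true  (suc k) zero    (s≤s ())
∷ᵇ-<-∷ᵇ⁻ b     c     (suc k) (suc m) (s≤s (s≤s lt)) =
  Sum.map s<s (λ { (k≡m , eqs) → cong suc k≡m , eqs }) (∷ᵇ-<-∷ᵇ⁻ b c k m lt)

⌊/2⌋-<-2^ : ∀ f {n} → n < 2 ^ suc f → ⌊ n /2⌋ < 2 ^ f
⌊/2⌋-<-2^ f {n} n<2^1+f
  with ∷ᵇ-<-∷ᵇ⁻ (lsb n) false ⌊ n /2⌋ (2 ^ f) (subst₂ _<_ (sym (lsb∷ᵇ⌊/2⌋ n)) (2^-suc f) n<2^1+f)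
... | inj₁ lt = lt
... | inj₂ (_ , _ , ())

xor-involutiveˡ : ∀ x y → x xor (x xor y) ≡ y
xor-involutiveˡ x y = trans (sym (xor-assoc x x y)) (cong (_xor y) (xor-same x))

xor≡true⁻ : ∀ x y → x xor y ≡ true → (x ≡ false × y ≡ true) ⊎ (x ≡ true × y ≡ false)
xor≡true⁻ false true  _ = inj₁ (refl , refl)
xor≡true⁻ true  false _ = inj₂ (refl , refl)

-- The nim-sum (bitwise exclusive or) of the lowest f bits of a and b.
nimSum : ℕ → ℕ → ℕ → ℕ
nimSum zero    a b = 0
nimSum (suc f) a b = (lsb a xor lsb b) ∷ᵇ nimSum f ⌊ a /2⌋ ⌊ b /2⌋

nimSum-∷ᵇˡ : ∀ f b x y → nimSum (suc f) (b ∷ᵇ x) y ≡ (b xor lsb y) ∷ᵇ nimSum f x ⌊ y /2⌋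
nimSum-∷ᵇˡ f b x y = cong₂ (λ c z → (c xor lsb y) ∷ᵇ nimSum f z ⌊ y /2⌋) (lsb-∷ᵇ b x) (⌊∷ᵇ/2⌋ b x)

nimSum-∷ᵇʳ : ∀ f x b y → nimSum (suc f) x (b ∷ᵇ y) ≡ (lsb x xor b) ∷ᵇ nimSum f ⌊ x /2⌋ y
nimSum-∷ᵇʳ f x b y = cong₂ (λ c z → (lsb x xor c) ∷ᵇ nimSum f ⌊ x /2⌋ z) (lsb-∷ᵇ b y) (⌊∷ᵇ/2⌋ b y)

nimSum-comm : ∀ f a b → nimSum f a b ≡ nimSum f b a
nimSum-comm zero    a b = refl
nimSum-comm (suc f) a b = cong₂ _∷ᵇ_ (xor-comm (lsb a) (lsb b)) (nimSum-comm f ⌊ a /2⌋ ⌊ b /2⌋)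

nimSum-< : ∀ f a b → nimSum f a b < 2 ^ f
nimSum-< zero    a b = z<s
nimSum-< (suc f) a b =
  subst (nimSum (suc f) a b <_) (sym (2^-suc f)) (∷ᵇ-<-∷ᵇ _ false (nimSum-< f ⌊ a /2⌋ ⌊ b /2⌋))

nimSum-identityʳ : ∀ f {a} → a < 2 ^ f → nimSum f a 0 ≡ a
nimSum-identityʳ zero    a<1 = sym (n<1⇒n≡0 a<1)
nimSum-identityʳ (suc f) {a} a<2^1+f = begin
  (lsb a xor false) ∷ᵇ nimSum f ⌊ a /2⌋ 0
    ≡⟨ cong₂ _∷ᵇ_ (xor-identityʳ (lsb a)) (nimSum-identityʳ f (⌊/2⌋-<-2^ f a<2^1+f)) ⟩
  lsb a ∷ᵇ ⌊ a /2⌋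
    ≡⟨ lsb∷ᵇ⌊/2⌋ a ⟩
  a ∎
  where open ≡-Reasoning

nimSum-cancelˡ : ∀ f a {y b} → y < 2 ^ f → b < 2 ^ f → nimSum f a y ≡ nimSum f a b → y ≡ b
nimSum-cancelˡ zero    a y<1 b<1 _ = trans (n<1⇒n≡0 y<1) (sym (n<1⇒n≡0 b<1))
nimSum-cancelˡ (suc f) a {y} {b} y<2^1+f b<2^1+f eq = begin
  y                  ≡⟨ sym (lsb∷ᵇ⌊/2⌋ y) ⟩
  lsb y ∷ᵇ ⌊ y /2⌋   ≡⟨ cong₂ _∷ᵇ_ lsb-eq halves-eq ⟩
  lsb b ∷ᵇ ⌊ b /2⌋   ≡⟨ lsb∷ᵇ⌊/2⌋ b ⟩
  b                  ∎
  where
  open ≡-Reasoning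
  lsb-eq : lsb y ≡ lsb b
  lsb-eq = begin
    lsb y                         ≡⟨ sym (xor-involutiveˡ (lsb a) (lsb y)) ⟩
    lsb a xor (lsb a xor lsb y)   ≡⟨ cong (lsb a xor_) (proj₁ (∷ᵇ-injective eq)) ⟩
    lsb a xor (lsb a xor lsb b)   ≡⟨ xor-involutiveˡ (lsb a) (lsb b) ⟩
    lsb b                         ∎
  halves-eq : ⌊ y /2⌋ ≡ ⌊ b /2⌋
  halves-eq = nimSum-cancelˡ f ⌊ a /2⌋ (⌊/2⌋-<-2^ f y<2^1+f) (⌊/2⌋-<-2^ f b<2^1+f)
                (proj₂ (∷ᵇ-injective eq))

nimSum-2^-+ : ∀ f j {w} → j < f → w < 2 ^ j → nimSum f (2 ^ j) w ≡ 2 ^ j + w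
nimSum-2^-+ (suc f) zero    {zero}  _ _ = cong (true ∷ᵇ_) (nimSum-identityʳ f (m^n>0 2 f))
nimSum-2^-+ (suc f) zero    {suc w} _ (s≤s ())
nimSum-2^-+ (suc f) (suc j) {w} (s≤s j<f) w<2^1+j = begin
  nimSum (suc f) (2 ^ suc j) w              ≡⟨ cong (λ x → nimSum (suc f) x w) (2^-suc j) ⟩
  nimSum (suc f) (false ∷ᵇ 2 ^ j) w         ≡⟨ nimSum-∷ᵇˡ f false (2 ^ j) w ⟩
  lsb w ∷ᵇ nimSum f (2 ^ j) ⌊ w /2⌋         ≡⟨ cong (lsb w ∷ᵇ_) (nimSum-2^-+ f j j<f (⌊/2⌋-<-2^ j w<2^1+j)) ⟩
  lsb w ∷ᵇ (2 ^ j + ⌊ w /2⌋)                ≡⟨ ∷ᵇ-+ (lsb w) (2 ^ j) ⌊ w /2⌋ ⟩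
  false ∷ᵇ 2 ^ j + lsb w ∷ᵇ ⌊ w /2⌋         ≡⟨ cong₂ _+_ (sym (2^-suc j)) (lsb∷ᵇ⌊/2⌋ w) ⟩
  2 ^ suc j + w                              ∎
  where open ≡-Reasoning

Reachable : ℕ → ℕ → ℕ → ℕ → Set
Reachable f a b z = ∃[ y ] y < b × nimSum f a y ≡ z

reachable-∷ᵇ : ∀ f a b z y → nimSum f ⌊ a /2⌋ y ≡ ⌊ z /2⌋ →
               (lsb a xor lsb z) ∷ᵇ y < b → Reachable (suc f) a b z
reachable-∷ᵇ f a b z y eq lt = _ , lt , (begin
  nimSum (suc f) a ((lsb a xor lsb z) ∷ᵇ y)         ≡⟨ nimSum-∷ᵇʳ f a (lsb a xor lsb z) y ⟩
  (lsb a xor (lsb a xor lsb z)) ∷ᵇ nimSum f ⌊ a /2⌋ y ≡⟨ cong₂ _∷ᵇ_ (xor-involutiveˡ (lsb a) (lsb z)) eq ⟩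
  lsb z ∷ᵇ ⌊ z /2⌋                                   ≡⟨ lsb∷ᵇ⌊/2⌋ z ⟩
  z                                                  ∎)
  where open ≡-Reasoning

reachable-odd : ∀ f a b z → lsb b ≡ true → lsb a ≡ lsb z →
                nimSum f ⌊ a /2⌋ ⌊ b /2⌋ ≡ ⌊ z /2⌋ → Reachable (suc f) a b z
reachable-odd f a b z b-odd a≡z eq = reachable-∷ᵇ f a b z ⌊ b /2⌋ eq (subst₂ _<_
  (cong (_∷ᵇ ⌊ b /2⌋) (sym (trans (cong (_xor lsb z) a≡z) (xor-same (lsb z)))))
  (trans (cong (_∷ᵇ ⌊ b /2⌋) (sym b-odd)) (lsb∷ᵇ⌊/2⌋ b))
  (false∷ᵇ<true∷ᵇ ⌊ b /2⌋))

nimSum-mex : ∀ f a b z → z < nimSum f a b → Reachable f a b z ⊎ Reachable f b a z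
nimSum-mex zero    a b z ()
nimSum-mex (suc f) a b z z<a⊕b
  with ∷ᵇ-<-∷ᵇ⁻ (lsb z) (lsb a xor lsb b) ⌊ z /2⌋ (nimSum f ⌊ a /2⌋ ⌊ b /2⌋)
         (subst (_< nimSum (suc f) a b) (sym (lsb∷ᵇ⌊/2⌋ z)) z<a⊕b)
... | inj₁ lt = Sum.map (lift a b) (lift b a) (nimSum-mex f ⌊ a /2⌋ ⌊ b /2⌋ ⌊ z /2⌋ lt)
  where
  lift : ∀ a b → Reachable f ⌊ a /2⌋ ⌊ b /2⌋ ⌊ z /2⌋ → Reachable (suc f) a b z
  lift a b (y , y<b , eq) = reachable-∷ᵇ f a b z y eq
    (subst (_ <_) (lsb∷ᵇ⌊/2⌋ b) (∷ᵇ-<-∷ᵇ (lsb a xor lsb z) (lsb b) y<b))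
... | inj₂ (halves-eq , z-even , a⊕b-odd) with xor≡true⁻ (lsb a) (lsb b) a⊕b-odd
...   | inj₁ (a-even , b-odd) =
        inj₁ (reachable-odd f a b z b-odd (trans a-even (sym z-even)) (sym halves-eq))
...   | inj₂ (a-odd , b-even) =
        inj₂ (reachable-odd f b a z a-odd (trans b-even (sym z-even))
               (trans (nimSum-comm f ⌊ b /2⌋ ⌊ a /2⌋) (sym halves-eq)))

n≤2^⌈log₂n⌉ : ∀ n → n ≤ 2 ^ ⌈log₂ n ⌉
n≤2^⌈log₂n⌉ = <-rec (λ n → n ≤ 2 ^ ⌈log₂ n ⌉) step
  where
  step : ∀ n → (∀ {m} → m < n → m ≤ 2 ^ ⌈log₂ m ⌉) → n ≤ 2 ^ ⌈log₂ n ⌉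
  step zero          _   = z≤n
  step (suc zero)    _   = s≤s z≤n
  step n@(suc (suc k)) rec = begin
    n                              ≡⟨ sym (⌊n/2⌋+⌈n/2⌉≡n n) ⟩
    ⌊ n /2⌋ + ⌈ n /2⌉              ≤⟨ +-monoˡ-≤ ⌈ n /2⌉ (⌊n/2⌋≤⌈n/2⌉ n) ⟩
    ⌈ n /2⌉ + ⌈ n /2⌉              ≤⟨ +-mono-≤ half≤ (subst (⌈ n /2⌉ ≤_) (sym (+-identityʳ _)) half≤) ⟩
    2 ^ suc (⌈log₂ n ⌉ ∸ 1)         ≡⟨⟩
    2 ^ ⌈log₂ n ⌉                  ∎
    where
    open ≤-Reasoning
    half≤ : ⌈ n /2⌉ ≤ 2 ^ (⌈log₂ n ⌉ ∸ 1)
    half≤ = subst (λ e → ⌈ n /2⌉ ≤ 2 ^ e) (⌈log₂⌈n/2⌉⌉≡⌈log₂n⌉∸1 n) (rec (⌈n/2⌉<n k))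

⌈log₂n⌉≡1+j⇒2^j<n : ∀ {n j} → ⌈log₂ n ⌉ ≡ suc j → 2 ^ j < n
⌈log₂n⌉≡1+j⇒2^j<n {n} {j} eq = ≰⇒> λ n≤2^j → 1+n≰n (begin
  suc j            ≡⟨ sym eq ⟩
  ⌈log₂ n ⌉        ≤⟨ ⌈log₂⌉-mono-≤ n≤2^j ⟩
  ⌈log₂ 2 ^ j ⌉    ≡⟨ ⌈log₂2^n⌉≡n j ⟩
  j                ∎)
  where open ≤-Reasoning

nimSum-image : ∀ {M} → 0 < M → ∀ {z} → z < 2 ^ ⌈log₂ M ⌉ →
               ∃[ a ] ∃[ b ] a < M × b < M × nimSum ⌈log₂ M ⌉ a b ≡ z
nimSum-image {M} 0<M {z} z<2^m with z <? M
... | yes z<M = z , 0 , z<M , 0<M , nimSum-identityʳ ⌈log₂ M ⌉ (<-≤-trans z<M (n≤2^⌈log₂n⌉ M))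
... | no  z≮M = above ⌈log₂ M ⌉ refl z<2^m
  where
  above : ∀ m → ⌈log₂ M ⌉ ≡ m → z < 2 ^ m → ∃[ a ] ∃[ b ] a < M × b < M × nimSum m a b ≡ z
  above zero    _  (s≤s z≤n) = contradiction 0<M z≮M
  above (suc j) eq z<2^1+j   =
    2 ^ j , w , 2^j<M , <-trans w<2^j 2^j<M , trans (nimSum-2^-+ (suc j) j ≤-refl w<2^j) (m+[n∸m]≡n 2^j≤z)
    where
    2^j<M : 2 ^ j < M
    2^j<M = ⌈log₂n⌉≡1+j⇒2^j<n eq
    2^j≤z : 2 ^ j ≤ z
    2^j≤z = <⇒≤ (<-≤-trans 2^j<M (≮⇒≥ z≮M))
    w : ℕ
    w = z ∸ 2 ^ j
    w<2^j : w < 2 ^ j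
    w<2^j = subst (w <_) (trans (m+n∸m≡n (2 ^ j) (2 ^ j + 0)) (+-identityʳ (2 ^ j)))
              (∸-monoˡ-< z<2^1+j 2^j≤z)

-- Counting distinct values

length-≤-⊆ : ∀ {A : Set} {xs ys : List A} → Unique xs → xs ⊆ ys → length xs ≤ length ys
length-≤-⊆ {xs = []}     _               _     = z≤n
length-≤-⊆ {xs = x ∷ xs} (x∉xs ∷ xs-uniq) xs⊆ys with ∈-∃++ (xs⊆ys (here refl))
... | ys₁ , ys₂ , refl =
  ≤-trans (s≤s (length-≤-⊆ xs-uniq xs⊆ys₁++ys₂)) (≤-reflexive (sym (↭-length (shift x ys₁ ys₂))))
  where
  xs⊆ys₁++ys₂ : xs ⊆ ys₁ ++ ys₂
  xs⊆ys₁++ys₂ {y} y∈xs with ∈-resp-↭ (shift x ys₁ ys₂) (xs⊆ys (there y∈xs))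
  ... | here y≡x    = contradiction (sym y≡x) (All.lookup x∉xs y∈xs)
  ... | there y∈ys′ = y∈ys′

length-deduplicate : ∀ {A : Set} (_≟ₐ_ : DecidableEquality A) {xs ys : List A} →
                     Unique ys → xs ⊆ ys → ys ⊆ xs → length (deduplicate _≟ₐ_ xs) ≡ length ys
length-deduplicate _≟ₐ_ {xs} ys-uniq xs⊆ys ys⊆xs = ≤-antisym
  (length-≤-⊆ (deduplicate-! _≟ₐ_ xs) (xs⊆ys ∘ ∈-deduplicate⁻ _≟ₐ_ xs))
  (length-≤-⊆ ys-uniq (∈-deduplicate⁺ _≟ₐ_ ∘ ys⊆xs))

Unique-applyUpTo-suc : ∀ n → Unique (applyUpTo suc n)
Unique-applyUpTo-suc n = applyUpTo⁺₁ suc n (λ i<j _ → <⇒≢ i<j ∘ suc-injective)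

∈-applyUpTo-suc⁺ : ∀ {c K} → 0 < c → c ≤ K → c ∈ applyUpTo suc K
∈-applyUpTo-suc⁺ (s≤s z≤n) c≤K = ∈-applyUpTo⁺ suc c≤K

length-deduplicate-map-interval : ∀ {A : Set} (f : A → ℕ) xs {K} →
  (∀ {x} → x ∈ xs → 0 < f x × f x ≤ K) → (∀ {k} → k < K → ∃[ x ] x ∈ xs × f x ≡ suc k) →
  length (deduplicate _≟_ (map f xs)) ≡ K
length-deduplicate-map-interval f xs {K} in-interval all-present = begin
  length (deduplicate _≟_ (map f xs)) ≡⟨ length-deduplicate _≟_ (Unique-applyUpTo-suc K) values⊆ ⊆values ⟩
  length (applyUpTo suc K)            ≡⟨ length-applyUpTo suc K ⟩
  K                                   ∎
  where
  open ≡-Reasoning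
  values⊆ : map f xs ⊆ applyUpTo suc K
  values⊆ c∈ = let x , x∈xs , c≡fx = ∈-map⁻ f c∈ ; 0<fx , fx≤K = in-interval x∈xs in
    subst (_∈ applyUpTo suc K) (sym c≡fx) (∈-applyUpTo-suc⁺ 0<fx fx≤K)
  ⊆values : applyUpTo suc K ⊆ map f xs
  ⊆values c∈ = let k , k<K , c≡1+k = ∈-applyUpTo⁻ suc c∈ ; x , x∈xs , fx≡1+k = all-present k<K in
    subst (_∈ map f xs) (trans fx≡1+k (sym c≡1+k)) (∈-map⁺ f x∈xs)

-- First-Fit colourings

record IsLeastMissing (P : ℕ → Set) (c : ℕ) : Set where
  field
    positive : 0 < c
    missing  : ¬ P c
    below    : ∀ {d} → 0 < d → d < c → P d

open IsLeastMissing public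

IsLeastMissing-unique : ∀ {P c c′} → IsLeastMissing P c → IsLeastMissing P c′ → c ≡ c′
IsLeastMissing-unique {c = c} {c′} least least′ with <-cmp c c′
... | tri< c<c′ _ _ = contradiction (below least′ (positive least) c<c′) (missing least)
... | tri≈ _ c≡c′ _ = c≡c′
... | tri> _ _ c′<c = contradiction (below least (positive least′) c′<c) (missing least′)

IsLeastMissing-cong : ∀ {P Q c} → (∀ {d} → P d ⇔ Q d) → IsLeastMissing P c → IsLeastMissing Q c
IsLeastMissing-cong P⇔Q least = record
  { positive = positive least
  ; missing  = missing least ∘ Equivalence.from P⇔Q
  ; below    = λ 0<d d<c → Equivalence.to P⇔Q (below least 0<d d<c)
  }

module FirstFitProperties {V : Set} (Adj : Rel V 0ℓ) (adj? : Decidable Adj) where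

  open FirstFit Adj adj?

  ∈?-reflects : ∀ c ds → Reflects (c ∈ ds) (c ∈? ds)
  ∈?-reflects c []       = ofⁿ λ ()
  ∈?-reflects c (d ∷ ds) with does (c ≟ d) | proof (c ≟ d)
  ... | true  | ofʸ refl = ofʸ (here refl)
  ... | false | ofⁿ c≢d  with c ∈? ds | ∈?-reflects c ds
  ...   | true  | ofʸ c∈ds = ofʸ (there c∈ds)
  ...   | false | ofⁿ c∉ds = ofⁿ λ { (here c≡d) → c≢d c≡d ; (there c∈ds) → c∉ds c∈ds }

  smallestFrom-spec : ∀ used fuel s → let r = smallestFrom fuel s used in
    s ≤ r × (∀ {d} → s ≤ d → d < r → d ∈ used) × (r ∉ used ⊎ r ≡ fuel + s)
  smallestFrom-spec used zero       s = ≤-refl , (λ s≤d d<s → contradiction s≤d (<⇒≱ d<s)) , inj₂ refl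
  smallestFrom-spec used (suc fuel) s with s ∈? used | ∈?-reflects s used
  ... | false | ofⁿ s∉used = ≤-refl , (λ s≤d d<s → contradiction s≤d (<⇒≱ d<s)) , inj₁ s∉used
  ... | true  | ofʸ s∈used with smallestFrom-spec used fuel (suc s)
  ...   | s<r , below-r , r-spec =
    <⇒≤ s<r , below-s , Sum.map₂ (λ r≡ → trans r≡ (+-suc fuel s)) r-spec
    where
    below-s : ∀ {d} → s ≤ d → d < smallestFrom fuel (suc s) used → d ∈ used
    below-s {d} s≤d d<r with s ≟ d
    ... | yes refl = s∈used
    ... | no  s≢d  = below-r (≤∧≢⇒< s≤d s≢d) d<r

  -- The fuel suffices: 1, 2, …, length used + 1 cannot all occur in used.
  mex₁-isLeastMissing : ∀ used → IsLeastMissing (_∈ used) (mex₁ used)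
  mex₁-isLeastMissing used with smallestFrom-spec used (suc (length used)) 1
  ... | 0<r , below-r , inj₁ r∉used = record { positive = 0<r ; missing = r∉used ; below = below-r }
  ... | _   , below-r , inj₂ r≡     = contradiction
    (length-≤-⊆ (Unique-applyUpTo-suc (suc (length used))) all-in-used) too-long
    where
    too-long : ¬ length (applyUpTo suc (suc (length used))) ≤ length used
    too-long = subst (λ l → ¬ l ≤ length used) (sym (length-applyUpTo suc _)) (<⇒≱ ≤-refl)
    all-in-used : applyUpTo suc (suc (length used)) ⊆ used
    all-in-used c∈ with ∈-applyUpTo⁻ suc c∈
    ... | k , k<1+l , refl = below-r (s≤s z≤n)
      (subst (suc k <_) (trans (cong suc (+-comm 1 (length used))) (sym r≡)) (s<s k<1+l))

  ∈-nbrColours⁻ : ∀ col w xs {d} → d ∈ nbrColours w (map < id , col > xs) →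
                  ∃[ x ] x ∈ xs × Adj w x × col x ≡ d
  ∈-nbrColours⁻ col w (x ∷ xs) d∈ with adj? w x | d∈
  ... | yes w~x | here d≡cx = x , here refl , w~x , sym d≡cx
  ... | yes _   | there d∈′ = Product.map₂ (Product.map₁ there) (∈-nbrColours⁻ col w xs d∈′)
  ... | no  _   | d∈′       = Product.map₂ (Product.map₁ there) (∈-nbrColours⁻ col w xs d∈′)

  ∈-nbrColours⁺ : ∀ col w {xs x} → x ∈ xs → Adj w x → col x ∈ nbrColours w (map < id , col > xs)
  ∈-nbrColours⁺ col w {y ∷ xs} x∈ w~x with adj? w y | x∈
  ... | yes _   | here refl = here refl
  ... | no  w≁y | here refl = contradiction w~x w≁y
  ... | yes _   | there x∈′ = there (∈-nbrColours⁺ col w x∈′ w~x)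
  ... | no  _   | there x∈′ = ∈-nbrColours⁺ col w x∈′ w~x

  module _ (_≺_ : Rel V 0ℓ) where

    EarlierNeighbourColour : (V → ℕ) → V → ℕ → Set
    EarlierNeighbourColour col w d = ∃[ x ] x ≺ w × Adj w x × col x ≡ d

    IsFirstFitColouring : (V → ℕ) → Set
    IsFirstFitColouring col = ∀ w → IsLeastMissing (EarlierNeighbourColour col w) (col w)

    mex₁-nbrColours⇔ : ∀ col w {pre} → (∀ {x} → x ∈ pre ⇔ x ≺ w) →
      col w ≡ mex₁ (nbrColours w (map < id , col > pre)) ⇔
      IsLeastMissing (EarlierNeighbourColour col w) (col w)
    mex₁-nbrColours⇔ col w {pre} pre⇔≺w = mk⇔
      (λ col-w≡ → IsLeastMissing-cong used⇔earlier
                    (subst (IsLeastMissing _) (sym col-w≡) (mex₁-isLeastMissing used)))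
      (λ least → sym (IsLeastMissing-unique (mex₁-isLeastMissing used)
                    (IsLeastMissing-cong (⇔.sym used⇔earlier) least)))
      where
      used : List ℕ
      used = nbrColours w (map < id , col > pre)
      used⇔earlier : ∀ {d} → d ∈ used ⇔ EarlierNeighbourColour col w d
      used⇔earlier = mk⇔
        (λ d∈ → let x , x∈pre , w~x , cx≡d = ∈-nbrColours⁻ col w pre d∈
                in x , Equivalence.to pre⇔≺w x∈pre , w~x , cx≡d)
        (λ { (x , x≺w , w~x , refl) → ∈-nbrColours⁺ col w (Equivalence.from pre⇔≺w x≺w) w~x })

    firstFit-downwardClosed : ∀ {col} → IsFirstFitColouring col →
                              ∀ {w d} → 0 < d → d ≤ col w → ∃[ x ] col x ≡ d
    firstFit-downwardClosed {col} isFF {w} {d} 0<d d≤cw with d ≟ col w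
    ... | yes refl = w , refl
    ... | no  d≢cw = let x , _ , _ , cx≡d = below (isFF w) 0<d (≤∧≢⇒< d≤cw d≢cw) in x , cx≡d

    module _ (≺-asym : Asymmetric _≺_) where

      SortedEnumeration : List V → Set
      SortedEnumeration xs = AllPairs _≺_ xs × (∀ x → x ∈ xs)

      ∈-prefix⇒≺ : ∀ pre {w post x} → AllPairs _≺_ (pre ++ w ∷ post) → x ∈ pre → x ≺ w
      ∈-prefix⇒≺ (y ∷ pre) (y≺later ∷ _) (here refl) = All.lookup y≺later (∈-++⁺ʳ pre (here refl))
      ∈-prefix⇒≺ (y ∷ pre) (_ ∷ sorted)  (there x∈)  = ∈-prefix⇒≺ pre sorted x∈

      ≺⇒∈-prefix : ∀ pre {w post x} → AllPairs _≺_ (pre ++ w ∷ post) → x ∈ pre ++ w ∷ post → x ≺ w → x ∈ pre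
      ≺⇒∈-prefix []        _              (here refl)     x≺x = contradiction x≺x (≺-asym x≺x)
      ≺⇒∈-prefix []        (w≺post ∷ _)   (there x∈post)  x≺w = contradiction (All.lookup w≺post x∈post) (≺-asym x≺w)
      ≺⇒∈-prefix (y ∷ pre) _              (here refl)     _   = here refl
      ≺⇒∈-prefix (y ∷ pre) (_ ∷ sorted)   (there x∈)      x≺w = there (≺⇒∈-prefix pre sorted x∈ x≺w)

      ∈-prefix⇔≺ : ∀ pre {w post} → SortedEnumeration (pre ++ w ∷ post) → ∀ {x} → x ∈ pre ⇔ x ≺ w
      ∈-prefix⇔≺ pre (sorted , complete) = mk⇔ (∈-prefix⇒≺ pre sorted) (≺⇒∈-prefix pre sorted (complete _))

      ∉-prefix : ∀ pre {w post} → AllPairs _≺_ (pre ++ w ∷ post) → w ∉ pre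
      ∉-prefix pre sorted w∈pre = ≺-asym (∈-prefix⇒≺ pre sorted w∈pre) (∈-prefix⇒≺ pre sorted w∈pre)

      SortedEnumeration-shift : ∀ done w vs → SortedEnumeration (done ++ w ∷ vs) →
                                SortedEnumeration ((done ++ [ w ]) ++ vs)
      SortedEnumeration-shift done w vs = subst SortedEnumeration (sym (++-assoc done [ w ] vs))

      colourAlong-firstFit : ∀ {col} → IsFirstFitColouring col → ∀ done vs → SortedEnumeration (done ++ vs) →
                             colourAlong (map < id , col > done) vs ≡ map < id , col > (done ++ vs)
      colourAlong-firstFit {col} isFF done []       _    = cong (map < id , col >) (sym (++-identityʳ done))
      colourAlong-firstFit {col} isFF done (w ∷ vs) enum = begin
        colourAlong (map < id , col > done ++ [ (w , mex₁ (nbrColours w (map < id , col > done))) ]) vs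
          ≡⟨ cong (λ c → colourAlong (map < id , col > done ++ [ (w , c) ]) vs) (sym col-w≡mex₁) ⟩
        colourAlong (map < id , col > done ++ map < id , col > [ w ]) vs
          ≡⟨ cong (λ ps → colourAlong ps vs) (sym (map-++ < id , col > done [ w ])) ⟩
        colourAlong (map < id , col > (done ++ [ w ])) vs
          ≡⟨ colourAlong-firstFit isFF (done ++ [ w ]) vs (SortedEnumeration-shift done w vs enum) ⟩
        map < id , col > ((done ++ [ w ]) ++ vs)
          ≡⟨ cong (map < id , col >) (++-assoc done [ w ] vs) ⟩
        map < id , col > (done ++ w ∷ vs) ∎
        where
        open ≡-Reasoning
        col-w≡mex₁ : col w ≡ mex₁ (nbrColours w (map < id , col > done))
        col-w≡mex₁ = Equivalence.from (mex₁-nbrColours⇔ col w (∈-prefix⇔≺ done enum)) (isFF w)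

      module _ (_≟ᵥ_ : DecidableEquality V) where

        recolour : (V → ℕ) → V → ℕ → V → ℕ
        recolour col x c y with y ≟ᵥ x
        ... | yes _ = c
        ... | no  _ = col y

        recolour-same : ∀ col x c → recolour col x c x ≡ c
        recolour-same col x c with x ≟ᵥ x
        ... | yes _   = refl
        ... | no  x≢x = contradiction refl x≢x

        recolour-other : ∀ col {x} c {y} → y ≢ x → recolour col x c y ≡ col y
        recolour-other col {x} c {y} y≢x with y ≟ᵥ x
        ... | yes y≡x = contradiction y≡x y≢x
        ... | no  _   = refl

        firstFit-extend : ∀ done vs col → SortedEnumeration (done ++ vs) →
          ∃[ col′ ] (∀ {x} → x ∈ done → col′ x ≡ col x) ×
                    (∀ {w} → w ∈ vs → IsLeastMissing (EarlierNeighbourColour col′ w) (col′ w))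
        firstFit-extend done []       col _    = col , (λ _ → refl) , λ ()
        firstFit-extend done (w ∷ vs) col enum
          with col′ , agrees′ , isLeast′ ← firstFit-extend (done ++ [ w ]) vs
                 (recolour col w (mex₁ (nbrColours w (map < id , col > done))))
                 (SortedEnumeration-shift done w vs enum)
          = col′ , agrees , isLeast
          where
          c : ℕ
          c = mex₁ (nbrColours w (map < id , col > done))
          agrees : ∀ {x} → x ∈ done → col′ x ≡ col x
          agrees x∈ = trans (agrees′ (∈-++⁺ˡ x∈))
            (recolour-other col c λ { refl → ∉-prefix done (proj₁ enum) x∈ })
          col′-w : col′ w ≡ mex₁ (nbrColours w (map < id , col′ > done))
          col′-w = begin
            col′ w                                       ≡⟨ agrees′ (∈-++⁺ʳ done (here refl)) ⟩
            recolour col w c w                           ≡⟨ recolour-same col w c ⟩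
            c                                            ≡⟨ cong (mex₁ ∘ nbrColours w) (map-cong-local
                                                              (All.tabulate (cong (_ ,_) ∘ sym ∘ agrees))) ⟩
            mex₁ (nbrColours w (map < id , col′ > done)) ∎
            where open ≡-Reasoning
          isLeast : ∀ {v} → v ∈ w ∷ vs → IsLeastMissing (EarlierNeighbourColour col′ v) (col′ v)
          isLeast (here refl) = Equivalence.to (mex₁-nbrColours⇔ col′ w (∈-prefix⇔≺ done enum)) col′-w
          isLeast (there v∈)  = isLeast′ v∈

      module _ {ord : List V} (enum : SortedEnumeration ord) where

        firstFitColouring-exists : DecidableEquality V → ∃[ col ] IsFirstFitColouring col
        firstFitColouring-exists _≟ᵥ_ =
          let col , _ , isLeast = firstFit-extend _≟ᵥ_ [] ord (λ _ → 0) enum in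
          col , λ w → isLeast (proj₂ enum w)

        FF≡#colours : ∀ {col} → IsFirstFitColouring col → FF ord ≡ length (deduplicate _≟_ (map col ord))
        FF≡#colours {col} isFF = cong (length ∘ deduplicate _≟_) (begin
          map proj₂ (firstFitColouring ord)     ≡⟨ cong (map proj₂) (colourAlong-firstFit isFF [] ord enum) ⟩
          map proj₂ (map < id , col > ord)       ≡⟨ sym (map-∘ ord) ⟩
          map col ord                            ∎)
          where open ≡-Reasoning

open FirstFitProperties

-- First-Fit on G □ G along the lexicographic order

-- First-Fit colours are positive, so pred loses nothing.
boxColouring : ∀ {V : Set} → ℕ → (V → ℕ) → V × V → ℕ
boxColouring f col (u , v) = suc (nimSum f (pred (col u)) (pred (col v)))

module _ {n} (G : SimpleGraph n) {_≺_ : Rel (Fin n) 0ℓ} (≺-asym : Asymmetric _≺_) where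

  boxColouring-firstFit : ∀ f {col} → IsFirstFitColouring (Adj G) (adj? G) _≺_ col → (∀ w → col w ≤ 2 ^ f) →
    IsFirstFitColouring (BoxAdj G) (box-adj? G) (×-Lex _≡_ _≺_ _≺_) (boxColouring f col)
  boxColouring-firstFit f {col} isFF col≤2^f (u , v) = record
    { positive = z<s
    ; missing  = missing′
    ; below    = below′
    }
    where
    g : Fin n → ℕ
    g = pred ∘ col
    col≡suc-g : ∀ w → col w ≡ suc (g w)
    col≡suc-g w with col w | positive (isFF w)
    ... | suc _ | _ = refl
    g<2^f : ∀ w → g w < 2 ^ f
    g<2^f w = subst (_≤ 2 ^ f) (col≡suc-g w) (col≤2^f w)
    same-colour : ∀ {x y} → g x ≡ g y → col x ≡ col y
    same-colour {x} {y} eq = trans (col≡suc-g x) (trans (cong suc eq) (sym (col≡suc-g y)))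
    ≺-irrefl : ∀ {x} → ¬ x ≺ x
    ≺-irrefl x≺x = ≺-asym x≺x x≺x
    missing′ : ¬ EarlierNeighbourColour (BoxAdj G) (box-adj? G) (×-Lex _≡_ _≺_ _≺_)
                   (boxColouring f col) (u , v) (boxColouring f col (u , v))
    missing′ (_ , inj₁ u≺u           , sameFst _    , _ ) = ≺-irrefl u≺u
    missing′ (_ , inj₂ (refl , v≺v)  , sameSnd _    , _ ) = ≺-irrefl v≺v
    missing′ ((_ , v′) , inj₂ (_ , v′≺v) , sameFst v~v′ , eq) =
      missing (isFF v) (v′ , v′≺v , v~v′ , same-colour
        (nimSum-cancelˡ f (g u) (g<2^f v′) (g<2^f v) (suc-injective eq)))
    missing′ ((u′ , _) , inj₁ u′≺u , sameSnd u~u′ , eq) =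
      missing (isFF u) (u′ , u′≺u , u~u′ , same-colour (nimSum-cancelˡ f (g v) (g<2^f u′) (g<2^f u)
        (trans (nimSum-comm f (g v) (g u′)) (trans (suc-injective eq) (nimSum-comm f (g u) (g v))))))
    below′ : ∀ {d} → 0 < d → d < boxColouring f col (u , v) →
             EarlierNeighbourColour (BoxAdj G) (box-adj? G) (×-Lex _≡_ _≺_ _≺_) (boxColouring f col) (u , v) d
    below′ {suc z} _ (s≤s z<gu⊕gv) with nimSum-mex f (g u) (g v) z z<gu⊕gv
    ... | inj₁ (y , y<gv , gu⊕y≡z) =
      let v′ , v′≺v , v~v′ , cv′≡ = below (isFF v) z<s (subst (suc y <_) (sym (col≡suc-g v)) (s<s y<gv))
      in (u , v′) , inj₂ (refl , v′≺v) , sameFst v~v′ , cong suc (trans (cong (nimSum f (g u) ∘ pred) cv′≡) gu⊕y≡z)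
    ... | inj₂ (x , x<gu , gv⊕x≡z) =
      let u′ , u′≺u , u~u′ , cu′≡ = below (isFF u) z<s (subst (suc x <_) (sym (col≡suc-g u)) (s<s x<gu))
      in (u′ , v) , inj₁ u′≺u , sameSnd u~u′ ,
         cong suc (trans (nimSum-comm f (g u′) (g v)) (trans (cong (nimSum f (g v) ∘ pred) cu′≡) gv⊕x≡z))

lex-sorted : ∀ {A : Set} {_≺_ : Rel A 0ℓ} {xs : List A} → AllPairs _≺_ xs →
             AllPairs (×-Lex _≡_ _≺_ _≺_) (concatMap (λ u → map (u ,_) xs) xs)
lex-sorted {xs = xs} sorted = AllPairs.concat⁺
  (All.map⁺ (All.tabulate λ _ → AllPairs.map⁺ (AllPairs.map (λ v≺v′ → inj₂ (refl , v≺v′)) sorted)))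
  (AllPairs.map⁺ (AllPairs.map (λ u≺u′ → All.map⁺ (All.tabulate λ _ → All.map⁺ (All.tabulate λ _ → inj₁ u≺u′))) sorted))

∈-lex : ∀ {A : Set} {xs : List A} {u v} → u ∈ xs → v ∈ xs → (u , v) ∈ concatMap (λ u → map (u ,_) xs) xs
∈-lex {xs = xs} u∈ v∈ = ∈-concat⁺′ (∈-map⁺ _ v∈) (∈-map⁺ (λ u → map (u ,_) xs) u∈)

module _ {n} (σ : Fin n ↔ Fin n) where

  open Inverse σ

  _≺σ_ : Rel (Fin n) 0ℓ
  x ≺σ y = to x Fin.< to y

  ≺σ-asym : Asymmetric _≺σ_
  ≺σ-asym = Fin.<-asym

  σ-order-sorted : AllPairs _≺σ_ (σ-order σ)
  σ-order-sorted = AllPairs.map⁺ (AllPairs.tabulate⁺-< λ {i} {j} →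
    subst₂ Fin._<_ (sym (strictlyInverseˡ i)) (sym (strictlyInverseˡ j)))

  ∈-σ-order : ∀ x → x ∈ σ-order σ
  ∈-σ-order x = subst (_∈ σ-order σ) (strictlyInverseʳ x) (∈-map⁺ from (∈-allFin (to x)))

module _ (n : ℕ) (G : SimpleGraph (suc n)) (σ : Fin (suc n) ↔ Fin (suc n)) where

  private
    _≺_ : Rel (Fin (suc n)) 0ℓ
    _≺_ = _≺σ_ σ
    _≺ₗ_ : Rel (Fin (suc n) × Fin (suc n)) 0ℓ
    _≺ₗ_ = ×-Lex _≡_ _≺_ _≺_
    ≺ₗ-asym : Asymmetric _≺ₗ_
    ≺ₗ-asym = ×-asymmetric {_≈₁_ = _≡_} {_<₁_ = _≺_} {_<₂_ = _≺_} sym (resp₂ _≺_) (≺σ-asym σ) (≺σ-asym σ)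

  σ-enumeration : SortedEnumeration (Adj G) (adj? G) _≺_ (≺σ-asym σ) (σ-order σ)
  σ-enumeration = σ-order-sorted σ , ∈-σ-order σ

  lex-enumeration : SortedEnumeration (BoxAdj G) (box-adj? G) _≺ₗ_ ≺ₗ-asym (lex-order σ)
  lex-enumeration = lex-sorted (σ-order-sorted σ) , λ (u , v) → ∈-lex (∈-σ-order σ u) (∈-σ-order σ v)

  module _ {col : Fin (suc n) → ℕ} (isFF : IsFirstFitColouring (Adj G) (adj? G) _≺_ col) where

    private
      wMax : Fin (suc n)
      wMax = argmax col Fin.zero (σ-order σ)

    maxColour : ℕ
    maxColour = col wMax

    col≤maxColour : ∀ w → col w ≤ maxColour
    col≤maxColour w = All.lookup (f[xs]≤f[argmax] {f = col} Fin.zero (σ-order σ)) (∈-σ-order σ w)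

    colour-below-max : ∀ {k} → k < maxColour → ∃[ w ] col w ≡ suc k
    colour-below-max = firstFit-downwardClosed (Adj G) (adj? G) _≺_ isFF z<s

    FF-G≡maxColour : FF-G G σ ≡ maxColour
    FF-G≡maxColour = trans (FF≡#colours (Adj G) (adj? G) _≺_ (≺σ-asym σ) σ-enumeration isFF)
      (length-deduplicate-map-interval col (σ-order σ) (λ {w} _ → positive (isFF w) , col≤maxColour w)
        λ k<max → let w , cw≡1+k = colour-below-max k<max in w , ∈-σ-order σ w , cw≡1+k)

    FF-G□G-lex≡2^⌈log₂maxColour⌉ : FF-G□G-lex G σ ≡ 2 ^ ⌈log₂ maxColour ⌉
    FF-G□G-lex≡2^⌈log₂maxColour⌉ = trans
      (FF≡#colours (BoxAdj G) (box-adj? G) _≺ₗ_ ≺ₗ-asym lex-enumeration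
        (boxColouring-firstFit G (≺σ-asym σ) m isFF (λ w → ≤-trans (col≤maxColour w) (n≤2^⌈log₂n⌉ maxColour))))
      (length-deduplicate-map-interval (boxColouring m col) (lex-order σ)
        (λ {(u , v)} _ → z<s , nimSum-< m (pred (col u)) (pred (col v))) present)
      where
      m : ℕ
      m = ⌈log₂ maxColour ⌉
      present : ∀ {k} → k < 2 ^ m → ∃[ x ] x ∈ lex-order σ × boxColouring m col x ≡ suc k
      present k<2^m =
        let a , b , a<max , b<max , a⊕b≡k = nimSum-image (positive (isFF wMax)) k<2^m
            u , cu≡1+a = colour-below-max a<max
            v , cv≡1+b = colour-below-max b<max
        in (u , v) , ∈-lex (∈-σ-order σ u) (∈-σ-order σ v) ,
           cong suc (trans (cong₂ (λ x y → nimSum m (pred x) (pred y)) cu≡1+a cv≡1+b) a⊕b≡k)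

theorem5 : (n : ℕ) (G : SimpleGraph (suc n)) (σ : Fin (suc n) ↔ Fin (suc n)) →
    FF-G□G-lex G σ ≡ 2 ^ ⌈log₂ FF-G G σ ⌉
theorem5 n G σ
  with col , isFF ← firstFitColouring-exists (Adj G) (adj? G) (_≺σ_ σ) (≺σ-asym σ) (σ-enumeration n G σ) Fin._≟_ = begin
  FF-G□G-lex G σ                     ≡⟨ FF-G□G-lex≡2^⌈log₂maxColour⌉ n G σ isFF ⟩
  2 ^ ⌈log₂ maxColour n G σ isFF ⌉   ≡⟨ cong (λ K → 2 ^ ⌈log₂ K ⌉) (sym (FF-G≡maxColour n G σ isFF)) ⟩
  2 ^ ⌈log₂ FF-G G σ ⌉               ∎
  where open ≡-Reasoning
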